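{- A polynomial $u\in\mathbb{Z}[x]$ of degree at least $1$ is locally nilpotent at $1$ if and only if it is of one of the following forms: (1) $(x-1)p(x)$ with $p(x)\in\mathbb{Z}[x]\setminus\{0\}$ (these are nilpotent at $1$ of index $1$); (2) $-2x+4+p(x)(x-1)(x-2)$ with $p(x)\in\mathbb{Z}[x]$ (these are nilpotent at $1$ of index $2$); (3) $-2x^2+7x-3+p(x)(x-1)(x-2)(x-3)$ with $p(x)\in\mathbb{Z}[x]$ (these are nilpotent at $1$ of index $3$); (4) $x+1$ (which is locally nilpotent but not nilpotent at $1$).
   Context: For $u\in\mathbb{Z}[x]$ of degree at least $1$, define iterates $u^{(1)}=u$ and $u^{(n+1)}(x)=u(u^{(n)}(x))$. $u$ is locally nilpotent at $r\in\mathbb{Z}$ if for every prime $p$ there exists $m\ge1$ with $u^{(m)}(r)\equiv 0\pmod p$. $u$ is nilpotent at $r$ if $u^{(n)}(r)=0$ for some $n\ge 1$, and the nilpotency index is the least such $n$. -}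

module Defs where

open import Data.Nat using (ℕ; zero; suc; _≤_; _<_)
open import Data.Nat.Primality using (Prime)
open import Data.Integer using (ℤ; +_; -_; _+_; _*_)
open import Data.Integer.Divisibility using (_∣_)
open import Data.List using (List; []; _∷_; map)
open import Data.Product using (∃; Σ; _×_; _,_)
open import Data.Sum using (_⊎_)
open import Relation.Binary.PropositionalEquality using (_≡_; _≢_)
open import Relation.Nullary using (¬_)

-- Polynomials in ℤ[x] as coefficient lists, lowest degree first.
-- Trailing zeros are allowed; equality of polynomials is coefficientwise.
Poly : Set
Poly = List ℤ

coeff : Poly → ℕ → ℤ
coeff []       _       = + 0
coeff (a ∷ p)  zero    = a
coeff (a ∷ p)  (suc i) = coeff p i

_≈ₚ_ : Poly → Poly → Set
p ≈ₚ q = ∀ i → coeff p i ≡ coeff q i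

IsZeroPoly : Poly → Set
IsZeroPoly p = ∀ i → coeff p i ≡ + 0

DegreeAtLeast1 : Poly → Set
DegreeAtLeast1 p = ∃ λ i → (1 ≤ i) × (coeff p i ≢ + 0)

_+ₚ_ : Poly → Poly → Poly
[]      +ₚ q       = q
(a ∷ p) +ₚ []      = a ∷ p
(a ∷ p) +ₚ (b ∷ q) = (a + b) ∷ (p +ₚ q)

_*ₚ_ : Poly → Poly → Poly
[]      *ₚ q = []
(a ∷ p) *ₚ q = map (a *_) q +ₚ (+ 0 ∷ (p *ₚ q))

eval : Poly → ℤ → ℤ
eval []      x = + 0
eval (a ∷ p) x = a + x * eval p x

iter : (ℤ → ℤ) → ℕ → ℤ → ℤ
iter f zero    x = x
iter f (suc n) x = f (iter f n x)

iterPoly : Poly → ℕ → ℤ → ℤ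
iterPoly u n r = iter (eval u) n r

LocallyNilpotentAt : Poly → ℤ → Set
LocallyNilpotentAt u r =
  ∀ (p : ℕ) → Prime p → ∃ λ m → (1 ≤ m) × ((+ p) ∣ iterPoly u m r)

NilpotentAt : Poly → ℤ → Set
NilpotentAt u r = ∃ λ n → (1 ≤ n) × (iterPoly u n r ≡ + 0)

NilpotentOfIndex : Poly → ℤ → ℕ → Set
NilpotentOfIndex u r n =
  (1 ≤ n) × (iterPoly u n r ≡ + 0) × (∀ k → 1 ≤ k → k < n → iterPoly u k r ≢ + 0)

xMinus : ℕ → Poly
xMinus a = (- (+ a)) ∷ (+ 1) ∷ []

Form1 : Poly → Set
Form1 u = Σ Poly λ p → (¬ IsZeroPoly p) × (u ≈ₚ (xMinus 1 *ₚ p))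

Form2 : Poly → Set
Form2 u = Σ Poly λ p →
  u ≈ₚ ((+ 4 ∷ - (+ 2) ∷ []) +ₚ (p *ₚ (xMinus 1 *ₚ xMinus 2)))

Form3 : Poly → Set
Form3 u = Σ Poly λ p →
  u ≈ₚ ((- (+ 3) ∷ + 7 ∷ - (+ 2) ∷ []) +ₚ (p *ₚ ((xMinus 1 *ₚ xMinus 2) *ₚ xMinus 3)))

Form4 : Poly → Set
Form4 u = u ≈ₚ (+ 1 ∷ + 1 ∷ [])

{-# OPTIONS --safe #-}
-- Write a n = u^(n)(1). Since x − y divides u(x) − u(y), a k − a 0 divides a (i + k) − a i, and
-- modulo any d the orbit stays among a 0, …, a n once a (n + 1) ≡ a i for some i ≤ n. Suppose the
-- orbit starts 1, 2, …, n + 1 and put w = a (n + 1) − (n + 2). The first fact makes w divisible by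
-- 1, …, n; the second, with local nilpotence, shows that every prime factor of a (n + 1) − a i
-- divides some a k = k + 1 ≤ n + 1. These constraints force w = 0, or w = −(n + 2) with n ≤ 2.
-- So either the orbit of 1 is 1, 0 or 1, 2, 0 or 1, 2, 3, 0, which gives the forms (1)–(3) by
-- synthetic division at 1, 2, 3, or it is 1, 2, 3, … and u agrees with x + 1 on positive integers.
module Submission where

open import Defs
open import Data.Integer using (+_)
open import Data.Product using (_×_)
open import Data.Sum using (_⊎_)
open import Function.Bundles using (_⇔_)
open import Relation.Nullary using (¬_)

open import Algebra.Bundles using (AbelianGroup)
open import Data.Empty using (⊥-elim)
open import Data.Integer using (ℤ; -1ℤ; -_; -[1+_]; _+_; _*_; _-_; ∣_∣)
import Data.Integer.Properties as ℤ
open import Data.Integer.Divisibility.Signed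
  using (_∣_; divides; quotient; _∣?_; ∣ᵤ⇒∣; ∣⇒∣ᵤ; ∣-refl; ∣-trans; ∣m∣n⇒∣m+n; ∣m∣n⇒∣m-n; ∣m+n∣m⇒∣n; ∣m+n∣n⇒∣m; ∣m⇒∣m*n)
open import Data.Integer.Tactic.RingSolver using (solve-∀)
open import Data.List using ([]; _∷_; map; drop)
open import Data.List.Relation.Unary.All using (_∷_)
open import Data.Nat as ℕ using (ℕ; zero; suc; _≤_; z≤n; s≤s; nonTrivial⇒n>1)
import Data.Nat.Properties as ℕₚ
open import Data.Nat.Divisibility
  using (divides; ∣⇒≤; _∣0) renaming (_∣_ to _∣ₙ_; ∣-refl to ∣ₙ-refl; ∣1⇒≡1 to ∣ₙ1⇒≡1)
open import Data.Nat.ListAction using (product)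
open import Data.Nat.Primality using (Prime; prime?; prime[2]; ¬prime[1]; prime⇒irreducible; prime⇒nonTrivial)
open import Data.Nat.Primality.Factorisation using (factorise)
open import Data.Product using (∃; _,_; proj₁; proj₂)
open import Data.Sum using (inj₁; inj₂; [_,_]′) renaming (map to map-⊎)
open import Function using (id; _∘_; case_of_)
open import Function.Bundles using (mk⇔)
open import Relation.Binary.PropositionalEquality
open import Relation.Nullary using (yes; no)
open import Relation.Nullary.Decidable using (from-yes; from-no)
open import Algebra.Properties.Group (AbelianGroup.group ℤ.+-0-abelianGroup)
  using () renaming (∙-cancelˡ to +-cancelˡ)

open ≡-Reasoning

-- Evaluation and synthetic division

eval-+ₚ : ∀ p q x → eval (p +ₚ q) x ≡ eval p x + eval q x
eval-+ₚ []      q       x = sym (ℤ.+-identityˡ _)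
eval-+ₚ (a ∷ p) []      x = sym (ℤ.+-identityʳ _)
eval-+ₚ (a ∷ p) (b ∷ q) x rewrite eval-+ₚ p q x = interchange a b x (eval p x) (eval q x)
  where
  interchange : ∀ a b x P Q → a + b + x * (P + Q) ≡ a + x * P + (b + x * Q)
  interchange = solve-∀

eval-scale : ∀ a q x → eval (map (a *_) q) x ≡ a * eval q x
eval-scale a []      x = sym (ℤ.*-zeroʳ a)
eval-scale a (b ∷ q) x rewrite eval-scale a q x = distrib a b x (eval q x)
  where
  distrib : ∀ a b x Q → a * b + x * (a * Q) ≡ a * (b + x * Q)
  distrib = solve-∀

eval-*ₚ : ∀ p q x → eval (p *ₚ q) x ≡ eval p x * eval q x
eval-*ₚ []      q x = refl
eval-*ₚ (a ∷ p) q x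
  rewrite eval-+ₚ (map (a *_) q) (+ 0 ∷ (p *ₚ q)) x | eval-scale a q x | eval-*ₚ p q x
  = distrib a x (eval p x) (eval q x)
  where
  distrib : ∀ a x P Q → a * Q + (+ 0 + x * (P * Q)) ≡ (a + x * P) * Q
  distrib = solve-∀

eval-zero : ∀ p → IsZeroPoly p → ∀ x → eval p x ≡ + 0
eval-zero []      _ x = refl
eval-zero (a ∷ p) h x =
  trans (cong₂ (λ c e → c + x * e) (h 0) (eval-zero p (h ∘ suc) x)) (trans (ℤ.+-identityˡ _) (ℤ.*-zeroʳ x))

eval-≈ₚ : ∀ p q → p ≈ₚ q → ∀ x → eval p x ≡ eval q x
eval-≈ₚ []      []      _ x = refl
eval-≈ₚ (a ∷ p) []      h x = eval-zero (a ∷ p) h x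
eval-≈ₚ []      (b ∷ q) h x = sym (eval-zero (b ∷ q) (sym ∘ h) x)
eval-≈ₚ (a ∷ p) (b ∷ q) h x = cong₂ (λ c e → c + x * e) (h 0) (eval-≈ₚ p q (h ∘ suc) x)

eval-split : ∀ p x → eval p x ≡ coeff p 0 + x * eval (drop 1 p) x
eval-split []      x = sym (trans (ℤ.+-identityˡ _) (ℤ.*-zeroʳ x))
eval-split (a ∷ p) x = refl

coeff-drop : ∀ p i → coeff p (suc i) ≡ coeff (drop 1 p) i
coeff-drop []      i = refl
coeff-drop (a ∷ p) i = refl

suc∣⇒≡0 : ∀ {n} → suc n ∣ₙ n → n ≡ 0
suc∣⇒≡0 {zero}  _ = refl
suc∣⇒≡0 {suc n} d = ⊥-elim (ℕₚ.<-irrefl refl (∣⇒≤ d))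

-- c − d is a multiple of every positive integer, hence 0.
affine-unique : ∀ {c d : ℤ} {P Q : ℕ → ℤ} →
                (∀ k → c + + suc k * P k ≡ d + + suc k * Q k) →
                c ≡ d × (∀ k → P k ≡ Q k)
affine-unique {c} {d} {P} {Q} h = c≡d , P≡Q
  where
  gap : ∀ k → c - d ≡ (Q k - P k) * + suc k
  gap k = begin
    c - d                                   ≡⟨ pad c d (+ suc k) (P k) ⟩
    c + + suc k * P k - + suc k * P k - d   ≡⟨ cong (λ t → t - + suc k * P k - d) (h k) ⟩
    d + + suc k * Q k - + suc k * P k - d   ≡⟨ unpad d (+ suc k) (P k) (Q k) ⟩
    (Q k - P k) * + suc k                   ∎
    where
    pad : ∀ c d s P → c - d ≡ c + s * P - s * P - d
    pad = solve-∀
    unpad : ∀ d s P Q → d + s * Q - s * P - d ≡ (Q - P) * s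
    unpad = solve-∀
  c≡d : c ≡ d
  c≡d = ℤ.i-j≡0⇒i≡j c d (ℤ.∣i∣≡0⇒i≡0 (suc∣⇒≡0 (divides ∣ Q k - P k ∣
          (trans (cong ∣_∣ (gap k)) (ℤ.abs-* (Q k - P k) (+ suc k))))))
    where k = ∣ c - d ∣
  P≡Q : ∀ k → P k ≡ Q k
  P≡Q k = ℤ.*-cancelˡ-≡ (+ suc k) (P k) (Q k)
            (+-cancelˡ c _ _ (trans (h k) (cong (_+ + suc k * Q k) (sym c≡d))))

values-drop : ∀ p q → (∀ k → eval p (+ suc k) ≡ eval q (+ suc k)) →
              coeff p 0 ≡ coeff q 0 × (∀ k → eval (drop 1 p) (+ suc k) ≡ eval (drop 1 q) (+ suc k))
values-drop p q h = affine-unique λ k →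
  trans (sym (eval-split p (+ suc k))) (trans (h k) (eval-split q (+ suc k)))

≈ₚ-from-values : ∀ p q → (∀ k → eval p (+ suc k) ≡ eval q (+ suc k)) → p ≈ₚ q
≈ₚ-from-values p q h zero    = proj₁ (values-drop p q h)
≈ₚ-from-values p q h (suc i) = begin
  coeff p (suc i)      ≡⟨ coeff-drop p i ⟩
  coeff (drop 1 p) i   ≡⟨ ≈ₚ-from-values (drop 1 p) (drop 1 q) (proj₂ (values-drop p q h)) i ⟩
  coeff (drop 1 q) i   ≡⟨ coeff-drop q i ⟨
  coeff q (suc i)      ∎

deflate : Poly → ℤ → Poly
deflate []      a = []
deflate (c ∷ p) a = eval p a ∷ deflate p a

eval-deflate : ∀ p a x → eval p x ≡ eval p a + (x - a) * eval (deflate p a) x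
eval-deflate []      a x = sym (trans (ℤ.+-identityˡ _) (ℤ.*-zeroʳ (x - a)))
eval-deflate (c ∷ p) a x rewrite eval-deflate p a x =
  regroup c a x (eval p a) (eval (deflate p a) x)
  where
  regroup : ∀ c a x P Q → c + x * (P + (x - a) * Q) ≡ c + a * P + (x - a) * (P + x * Q)
  regroup = solve-∀

eval-deflate-value : ∀ p {a c} → eval p a ≡ c → ∀ x → eval p x ≡ c + (x - a) * eval (deflate p a) x
eval-deflate-value p {a} pₐ≡c x = trans (eval-deflate p a x) (cong (_+ (x - a) * eval (deflate p a) x) pₐ≡c)

eval-deflate-root : ∀ p {a} → eval p a ≡ + 0 → ∀ x → eval p x ≡ (x - a) * eval (deflate p a) x
eval-deflate-root p pₐ≡0 x = trans (eval-deflate-value p pₐ≡0 x) (ℤ.+-identityˡ _)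

eval-difference-∣ : ∀ p x y → (x - y) ∣ eval p x - eval p y
eval-difference-∣ p x y = divides (eval (deflate p y) x) (begin
  eval p x - eval p y                                 ≡⟨ cong (_- eval p y) (eval-deflate p y x) ⟩
  eval p y + (x - y) * eval (deflate p y) x - eval p y ≡⟨ cancel (eval p y) (x - y) (eval (deflate p y) x) ⟩
  eval (deflate p y) x * (x - y)                      ∎)
  where
  cancel : ∀ c d q → c + d * q - c ≡ q * d
  cancel = solve-∀

form₁-poly form₂-poly form₃-poly : Poly → Poly
form₁-poly q = xMinus 1 *ₚ q
form₂-poly q = (+ 4 ∷ - (+ 2) ∷ []) +ₚ (q *ₚ (xMinus 1 *ₚ xMinus 2))
form₃-poly q = (- (+ 3) ∷ + 7 ∷ - (+ 2) ∷ []) +ₚ (q *ₚ ((xMinus 1 *ₚ xMinus 2) *ₚ xMinus 3))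

form₄-poly : Poly
form₄-poly = + 1 ∷ + 1 ∷ []

-- Newton forms of (1)–(3) at the nodes 1; 2, 1; 3, 2, 1, which display the values at 1, 2, 3.
eval-form₁ : ∀ q x → eval (form₁-poly q) x ≡ (x - + 1) * eval q x
eval-form₁ q x rewrite eval-*ₚ (xMinus 1) q x = cong (_* eval q x) (linear x)
  where
  linear : ∀ x → - + 1 + x * (+ 1 + x * + 0) ≡ x - + 1
  linear = solve-∀

eval-form₂ : ∀ q x →
  eval (form₂-poly q) x ≡
  (x - + 2) * (- + 2 + (x - + 1) * eval q x)
eval-form₂ q x
  rewrite eval-+ₚ (+ 4 ∷ - (+ 2) ∷ []) (q *ₚ (xMinus 1 *ₚ xMinus 2)) x
        | eval-*ₚ q (xMinus 1 *ₚ xMinus 2) x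
        | eval-*ₚ (xMinus 1) (xMinus 2) x
  = newton x (eval q x)
  where
  newton : ∀ x Q →
    + 4 + x * (- + 2 + x * + 0) + Q * ((- + 1 + x * (+ 1 + x * + 0)) * (- + 2 + x * (+ 1 + x * + 0))) ≡
    (x - + 2) * (- + 2 + (x - + 1) * Q)
  newton = solve-∀

eval-form₃ : ∀ q x →
  eval (form₃-poly q) x ≡
  (x - + 3) * (- + 3 + (x - + 2) * (- + 2 + (x - + 1) * eval q x))
eval-form₃ q x
  rewrite eval-+ₚ (- (+ 3) ∷ + 7 ∷ - (+ 2) ∷ []) (q *ₚ ((xMinus 1 *ₚ xMinus 2) *ₚ xMinus 3)) x
        | eval-*ₚ q ((xMinus 1 *ₚ xMinus 2) *ₚ xMinus 3) x
        | eval-*ₚ (xMinus 1 *ₚ xMinus 2) (xMinus 3) x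
        | eval-*ₚ (xMinus 1) (xMinus 2) x
  = newton x (eval q x)
  where
  newton : ∀ x Q →
    - + 3 + x * (+ 7 + x * (- + 2 + x * + 0)) +
      Q * ((- + 1 + x * (+ 1 + x * + 0)) * (- + 2 + x * (+ 1 + x * + 0)) * (- + 3 + x * (+ 1 + x * + 0))) ≡
    (x - + 3) * (- + 3 + (x - + 2) * (- + 2 + (x - + 1) * Q))
  newton = solve-∀

eval-form₄ : ∀ x → eval form₄-poly x ≡ + 1 + x
eval-form₄ = linear
  where
  linear : ∀ x → + 1 + x * (+ 1 + x * + 0) ≡ + 1 + x
  linear = solve-∀

c≡-1*q⇒q≡-c : ∀ {q c : ℤ} → c ≡ -1ℤ * q → q ≡ - c
c≡-1*q⇒q≡-c {q} c≡-q = trans (sym (ℤ.neg-involutive q)) (cong -_ (trans (sym (ℤ.-1*i≡-i q)) (sym c≡-q)))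

module FormValues (u : Poly) where

  form₁-root : Form1 u → eval u (+ 1) ≡ + 0
  form₁-root (q , _ , u≈) = trans (eval-≈ₚ u (form₁-poly q) u≈ (+ 1)) (eval-form₁ q (+ 1))

  form₂-values : Form2 u → eval u (+ 1) ≡ + 2 × eval u (+ 2) ≡ + 0
  form₂-values (q , u≈) = at (+ 1) , at (+ 2)
    where
    at : ∀ x → eval u x ≡ (x - + 2) * (- + 2 + (x - + 1) * eval q x)
    at x = trans (eval-≈ₚ u (form₂-poly q) u≈ x) (eval-form₂ q x)

  form₃-values : Form3 u → eval u (+ 1) ≡ + 2 × eval u (+ 2) ≡ + 3 × eval u (+ 3) ≡ + 0
  form₃-values (q , u≈) = at (+ 1) , at (+ 2) , at (+ 3)
    where
    at : ∀ x → eval u x ≡ (x - + 3) * (- + 3 + (x - + 2) * (- + 2 + (x - + 1) * eval q x))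
    at x = trans (eval-≈ₚ u (form₃-poly q) u≈ x) (eval-form₃ q x)

  form₄-values : Form4 u → ∀ x → eval u x ≡ + 1 + x
  form₄-values u≈ x = trans (eval-≈ₚ u form₄-poly u≈ x) (eval-form₄ x)

  root⇒form₁ : DegreeAtLeast1 u → eval u (+ 1) ≡ + 0 → Form1 u
  root⇒form₁ (i , _ , uᵢ≢0) u₁≡0 =
    q , q≢0 , ≈ₚ-from-values u (form₁-poly q) (λ k → trans (factor (+ suc k)) (sym (eval-form₁ q (+ suc k))))
    where
    q = deflate u (+ 1)
    factor : ∀ x → eval u x ≡ (x - + 1) * eval q x
    factor = eval-deflate-root u u₁≡0
    q≢0 : ¬ IsZeroPoly q
    q≢0 q≡0 = uᵢ≢0 (≈ₚ-from-values u [] (λ k →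
      trans (factor (+ suc k)) (trans (cong (+ k *_) (eval-zero q q≡0 (+ suc k))) (ℤ.*-zeroʳ (+ k)))) i)

  values⇒form₂ : eval u (+ 1) ≡ + 2 → eval u (+ 2) ≡ + 0 → Form2 u
  values⇒form₂ u₁≡2 u₂≡0 =
    q₂ , ≈ₚ-from-values u (form₂-poly q₂) (λ k → trans (newton (+ suc k)) (sym (eval-form₂ q₂ (+ suc k))))
    where
    q₁ = deflate u (+ 2)
    q₂ = deflate q₁ (+ 1)
    q₁-at-1 : eval q₁ (+ 1) ≡ - + 2
    q₁-at-1 = c≡-1*q⇒q≡-c (trans (sym u₁≡2) (eval-deflate-root u u₂≡0 (+ 1)))
    newton : ∀ x → eval u x ≡ (x - + 2) * (- + 2 + (x - + 1) * eval q₂ x)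
    newton x = trans (eval-deflate-root u u₂≡0 x) (cong ((x - + 2) *_) (eval-deflate-value q₁ q₁-at-1 x))

  values⇒form₃ : eval u (+ 1) ≡ + 2 → eval u (+ 2) ≡ + 3 → eval u (+ 3) ≡ + 0 → Form3 u
  values⇒form₃ u₁≡2 u₂≡3 u₃≡0 =
    q₃ , ≈ₚ-from-values u (form₃-poly q₃) (λ k → trans (newton (+ suc k)) (sym (eval-form₃ q₃ (+ suc k))))
    where
    q₁ = deflate u (+ 3)
    q₂ = deflate q₁ (+ 2)
    q₃ = deflate q₂ (+ 1)
    q₁-at-2 : eval q₁ (+ 2) ≡ - + 3
    q₁-at-2 = c≡-1*q⇒q≡-c (trans (sym u₂≡3) (eval-deflate-root u u₃≡0 (+ 2)))
    q₁≡ : ∀ x → eval q₁ x ≡ - + 3 + (x - + 2) * eval q₂ x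
    q₁≡ = eval-deflate-value q₁ q₁-at-2
    q₂-at-1 : eval q₂ (+ 1) ≡ - + 2
    q₂-at-1 = ℤ.*-cancelˡ-≡ (+ 2) _ _ (begin
      + 2 * eval q₂ (+ 1)                                ≡⟨ isolate (eval q₂ (+ 1)) ⟩
      - + 2 * (- + 3 + -1ℤ * eval q₂ (+ 1)) - + 6        ≡⟨ cong (λ t → - + 2 * t - + 6) (sym (q₁≡ (+ 1))) ⟩
      - + 2 * eval q₁ (+ 1) - + 6                        ≡⟨ cong (_- + 6) (sym (eval-deflate-root u u₃≡0 (+ 1))) ⟩
      eval u (+ 1) - + 6                                 ≡⟨ cong (_- + 6) u₁≡2 ⟩
      + 2 * - + 2                                        ∎)
      where
      isolate : ∀ Q → + 2 * Q ≡ - + 2 * (- + 3 + -1ℤ * Q) - + 6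
      isolate = solve-∀
    newton : ∀ x → eval u x ≡ (x - + 3) * (- + 3 + (x - + 2) * (- + 2 + (x - + 1) * eval q₃ x))
    newton x = trans (eval-deflate-root u u₃≡0 x) (cong ((x - + 3) *_)
                 (trans (q₁≡ x) (cong (λ t → - + 3 + (x - + 2) * t) (eval-deflate-value q₂ q₂-at-1 x))))

  values⇒form₄ : (∀ k → eval u (+ suc k) ≡ + suc (suc k)) → Form4 u
  values⇒form₄ h = ≈ₚ-from-values u form₄-poly (λ k → trans (h k) (sym (eval-form₄ (+ suc k))))

-- Integers without prime factors

prime[3] : Prime 3
prime[3] = from-yes (prime? 3)

prime[5] : Prime 5
prime[5] = from-yes (prime? 5)

prime⇒≥2 : ∀ {p} → Prime p → 2 ≤ p
prime⇒≥2 {p} pp = nonTrivial⇒n>1 p {{prime⇒nonTrivial pp}}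

prime∤1 : ∀ {p} → Prime p → ¬ p ∣ₙ 1
prime∤1 pp p∣1 = ¬prime[1] (subst Prime (∣ₙ1⇒≡1 p∣1) pp)

prime∣prime⇒≡ : ∀ {p q} → Prime p → Prime q → p ∣ₙ q → p ≡ q
prime∣prime⇒≡ pp pq p∣q with prime⇒irreducible pq p∣q
... | inj₁ p≡1 = ⊥-elim (¬prime[1] (subst Prime p≡1 pp))
... | inj₂ p≡q = p≡q

∃-prime-divisor : ∀ m → ∃ λ p → Prime p × p ∣ₙ suc (suc m)
∃-prime-divisor m with factorise (suc (suc m))
... | record { factors = [] ; isFactorisation = () }
... | record { factors = p ∷ ps ; isFactorisation = m≡∏ ; factorsPrime = pp ∷ _ } =
  p , pp , divides (product ps) (trans m≡∏ (ℕₚ.*-comm p (product ps)))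

PrimeFree : ℤ → Set
PrimeFree z = ∀ {p} → Prime p → ¬ (+ p ∣ z)

primeFree⇒±1 : ∀ z → PrimeFree z → z ≡ + 1 ⊎ z ≡ - + 1
primeFree⇒±1 (+ 0)           z↯ = ⊥-elim (z↯ prime[2] (divides (+ 0) refl))
primeFree⇒±1 (+ 1)           z↯ = inj₁ refl
primeFree⇒±1 (+ suc (suc m)) z↯ with p , pp , p∣ ← ∃-prime-divisor m = ⊥-elim (z↯ pp (∣ᵤ⇒∣ p∣))
primeFree⇒±1 -[1+ 0 ]        z↯ = inj₂ refl
primeFree⇒±1 -[1+ suc m ]    z↯ with p , pp , p∣ ← ∃-prime-divisor m = ⊥-elim (z↯ pp (∣ᵤ⇒∣ p∣))

primeFree-shift : ∀ {x} c → PrimeFree (x + c) → x ≡ + 1 - c ⊎ x ≡ - + 1 - c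
primeFree-shift {x} c x+c↯ = map-⊎ unshift unshift (primeFree⇒±1 (x + c) x+c↯)
  where
  cancel : ∀ x c → x ≡ x + c - c
  cancel = solve-∀
  unshift : ∀ {d} → x + c ≡ d → x ≡ d - c
  unshift e = trans (cancel x c) (cong (_- c) e)

∣-gap : ∀ {d} x {a b} → d ∣ x + a → d ∣ x + b → d ∣ b - a
∣-gap {d} x {a} {b} d∣x+a d∣x+b = subst (d ∣_) (gap x a b) (∣m∣n⇒∣m-n d∣x+b d∣x+a)
  where
  gap : ∀ x a b → x + b - (x + a) ≡ b - a
  gap = solve-∀

-- The staircase

-- When the orbit of 1 starts 1, 2, …, N + 1, these are the properties of w = u^(N+1)(1) − (N + 2).
record Staircase (N : ℕ) (w : ℤ) : Set where
  field
    divisible : ∀ {k} → 1 ≤ k → k ≤ N → + k ∣ w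
    smooth    : ∀ {p j} → Prime p → j ≤ N → + p ∣ w + + suc j → p ≤ suc N

module _ {N : ℕ} {w : ℤ} (S : Staircase N w) where
  open Staircase S

  prime≤N⇒∣ : ∀ {p} → Prime p → p ≤ N → + p ∣ w
  prime≤N⇒∣ pp = divisible (ℕₚ.≤-trans (s≤s z≤n) (prime⇒≥2 pp))

  prime-divisor-shift : ∀ {p j} → Prime p → j ≤ N → + p ∣ w + + suc j → p ≡ suc N ⊎ p ∣ₙ suc j
  prime-divisor-shift pp j≤N p∣ with ℕₚ.m≤n⇒m<n∨m≡n (smooth pp j≤N p∣)
  ... | inj₁ (s≤s p≤N) = inj₂ (∣⇒∣ᵤ (∣m+n∣m⇒∣n p∣ (prime≤N⇒∣ pp p≤N)))
  ... | inj₂ p≡1+N     = inj₁ p≡1+N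

  -- 5 divides 0 but exceeds N + 1.
  shift≢0 : ∀ {j} → N ≤ 3 → j ≤ N → w + + suc j ≢ + 0
  shift≢0 N≤3 j≤N e = from-no (5 ℕₚ.≤? 4)
    (ℕₚ.≤-trans (smooth prime[5] j≤N (subst (+ 5 ∣_) (sym e) (divides (+ 0) refl))) (s≤s N≤3))

  w+1-unit : ¬ (+ suc N ∣ w + + 1) → w ≡ + 0 ⊎ w ≡ - + 2
  w+1-unit ∤ = primeFree-shift (+ 1) w+1↯
    where
    w+1↯ : PrimeFree (w + + 1)
    w+1↯ pp p∣ with prime-divisor-shift pp z≤n p∣
    ... | inj₁ refl = ∤ p∣
    ... | inj₂ p∣1  = prime∤1 pp p∣1

  w+1+N-unit : 1 ≤ N → Prime (suc N) → + suc N ∣ w + + 1 →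
               w ≡ + 1 - + suc N ⊎ w ≡ - + 1 - + suc N
  w+1+N-unit (s≤s z≤n) prime[1+N] top = primeFree-shift (+ suc N) w+1+N↯
    where
    w+1+N↯ : PrimeFree (w + + suc N)
    w+1+N↯ {p} pp p∣ = 1+N∤w+1+N (subst (λ q → + q ∣ w + + suc N) p≡1+N p∣)
      where
      p≡1+N : p ≡ suc N
      p≡1+N with prime-divisor-shift pp ℕₚ.≤-refl p∣
      ... | inj₁ p≡1+N = p≡1+N
      ... | inj₂ p∣1+N = prime∣prime⇒≡ pp prime[1+N] p∣1+N
      1+N∤w+1+N : ¬ (+ suc N ∣ w + + suc N)
      1+N∤w+1+N d = ℕₚ.1+n≢0 (suc∣⇒≡0 (∣⇒∣ᵤ (∣-gap w top d)))

-- 2, 3 and 4 divide w. Writing w = 2m, a prime factor of m + 1 divides w + 2, so it is either N + 1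
-- (impossible, N + 1 divides w + 1) or 2 (impossible, 4 does not divide w + 2): hence m + 1 = ±1.
staircase-large-with-top : ∀ {N w} → Staircase N w → 4 ≤ N → + suc N ∣ w + + 1 → w ≡ + 0
staircase-large-with-top {N} {w} S 4≤N top =
  [ w≡0 , (λ m≡-2 → ⊥-elim (3∤-4 (subst (+ 3 ∣_) (w≡2m m≡-2) 3∣w))) ]′ (primeFree-shift (+ 1) m+1↯)
  where
  open Staircase S
  divisible≤4 : ∀ {k} → 1 ≤ k → k ≤ 4 → + k ∣ w
  divisible≤4 1≤k k≤4 = divisible 1≤k (ℕₚ.≤-trans k≤4 4≤N)
  2∣w = divisible≤4 (s≤s z≤n) (s≤s (s≤s z≤n))
  3∣w = divisible≤4 (s≤s z≤n) (s≤s (s≤s (s≤s z≤n)))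
  4∣w = divisible≤4 (s≤s z≤n) ℕₚ.≤-refl
  3∤-4 = from-no (+ 3 ∣? - + 4)
  m = quotient 2∣w
  w≡2m : ∀ {c} → m ≡ c → w ≡ c * + 2
  w≡2m m≡c = trans (_∣_.equality 2∣w) (cong (_* + 2) m≡c)
  w≡0 : m ≡ + 0 → w ≡ + 0
  w≡0 = w≡2m
  w+2≡2[m+1] : w + + 2 ≡ (m + + 1) * + 2
  w+2≡2[m+1] = trans (cong (_+ + 2) (w≡2m refl)) (double m)
    where
    double : ∀ m → m * + 2 + + 2 ≡ (m + + 1) * + 2
    double = solve-∀
  ∣m+1⇒∣w+2 : ∀ {d} → d ∣ m + + 1 → d ∣ w + + 2
  ∣m+1⇒∣w+2 d∣ = subst (_ ∣_) (sym w+2≡2[m+1]) (∣m⇒∣m*n (+ 2) d∣)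
  2∤m+1 : ¬ (+ 2 ∣ m + + 1)
  2∤m+1 (divides t m+1≡2t) = from-no (+ 4 ∣? + 2) (∣m+n∣m⇒∣n 4∣w+2 4∣w)
    where
    4∣w+2 : + 4 ∣ w + + 2
    4∣w+2 = divides t (begin
      w + + 2           ≡⟨ w+2≡2[m+1] ⟩
      (m + + 1) * + 2   ≡⟨ cong (_* + 2) m+1≡2t ⟩
      t * + 2 * + 2     ≡⟨ ℤ.*-assoc t (+ 2) (+ 2) ⟩
      t * + 4           ∎)
  m+1↯ : PrimeFree (m + + 1)
  m+1↯ {r} pr r∣m+1 with prime-divisor-shift S pr (ℕₚ.≤-trans (s≤s z≤n) 4≤N) (∣m+1⇒∣w+2 r∣m+1)
  ... | inj₁ refl = prime∤1 pr (∣⇒∣ᵤ (∣-gap w top (∣m+1⇒∣w+2 r∣m+1)))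
  ... | inj₂ r∣2 with refl ← prime∣prime⇒≡ pr prime[2] r∣2 = 2∤m+1 r∣m+1

-2-not-staircase : ∀ N → ¬ Staircase (suc N) (- + 2)
-2-not-staircase zero          S = shift≢0 S (s≤s z≤n) (s≤s z≤n) refl
-2-not-staircase (suc zero)    S = shift≢0 S (s≤s (s≤s z≤n)) (s≤s z≤n) refl
-2-not-staircase (suc (suc N)) S =
  from-no (+ 3 ∣? - + 2) (Staircase.divisible S (s≤s z≤n) (s≤s (s≤s (s≤s z≤n))))

staircase-without-top : ∀ N {w} → Staircase (suc N) w → ¬ (+ suc (suc N) ∣ w + + 1) → w ≡ + 0
staircase-without-top N S ∤ with w+1-unit S ∤
... | inj₁ w≡0  = w≡0
... | inj₂ refl = ⊥-elim (-2-not-staircase N S)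

staircase-with-top : ∀ N {w} → Staircase (suc N) w → + suc (suc N) ∣ w + + 1 →
                     w ≡ + 0 ⊎ (w ≡ - + suc (suc (suc N)) × suc N ≤ 2)
staircase-with-top zero S top with w+1+N-unit S (s≤s z≤n) prime[2] top
... | inj₁ refl = ⊥-elim (shift≢0 S (s≤s z≤n) z≤n refl)
... | inj₂ refl = inj₂ (refl , s≤s z≤n)
staircase-with-top (suc zero) S top with w+1+N-unit S (s≤s z≤n) prime[3] top
... | inj₁ refl = ⊥-elim (shift≢0 S (s≤s (s≤s z≤n)) (s≤s z≤n) refl)
... | inj₂ refl = inj₂ (refl , s≤s (s≤s z≤n))
staircase-with-top (suc (suc zero)) S top = ⊥-elim (from-no (+ 2 ∣? + 1)
  (∣m+n∣m⇒∣n (∣-trans (divides (+ 2) refl) top) (Staircase.divisible S (s≤s z≤n) (s≤s (s≤s z≤n)))))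
staircase-with-top (suc (suc (suc N))) S top =
  inj₁ (staircase-large-with-top S (s≤s (s≤s (s≤s (s≤s z≤n)))) top)

staircase-solution : ∀ N {w} → Staircase N w → w ≡ + 0 ⊎ (w ≡ - + suc (suc N) × N ≤ 2)
staircase-solution zero {w} S = map-⊎ id (_, z≤n) (primeFree-shift (+ 1) w+1↯)
  where
  w+1↯ : PrimeFree (w + + 1)
  w+1↯ pp p∣ = ℕₚ.<-irrefl refl (ℕₚ.≤-trans (prime⇒≥2 pp) (Staircase.smooth S pp z≤n p∣))
staircase-solution (suc N) {w} S with + suc (suc N) ∣? w + + 1
... | no ∤    = inj₁ (staircase-without-top N S ∤)
... | yes top = staircase-with-top N S top

-- Orbits

module Orbit (f : ℤ → ℤ) (f-∣ : ∀ x y → (x - y) ∣ f x - f y) (x₀ : ℤ) where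

  a : ℕ → ℤ
  a m = iter f m x₀

  iter-∣ : ∀ i x y → (x - y) ∣ iter f i x - iter f i y
  iter-∣ zero    x y = ∣-refl
  iter-∣ (suc i) x y = ∣-trans (iter-∣ i x y) (f-∣ _ _)

  iter-+ : ∀ i k x → iter f (i ℕ.+ k) x ≡ iter f i (iter f k x)
  iter-+ zero    k x = refl
  iter-+ (suc i) k x = cong f (iter-+ i k x)

  orbit-∣ : ∀ i k → (a k - x₀) ∣ a (i ℕ.+ k) - a i
  orbit-∣ i k rewrite iter-+ i k x₀ = iter-∣ i (a k) x₀

  -- Modulo d the orbit re-enters {a 0, …, a n} at a (n + 1), so it never leaves that set.
  orbit-recurrent : ∀ {d n i} → i ≤ n → d ∣ a (suc n) - a i → ∀ m → ∃ λ k → k ≤ n × d ∣ a m - a k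
  orbit-recurrent i≤n d∣ zero = zero , z≤n , subst (_ ∣_) (sym (ℤ.+-inverseʳ x₀)) (divides (+ 0) refl)
  orbit-recurrent {d} {n} {i} i≤n d∣ (suc m) with orbit-recurrent i≤n d∣ m
  ... | k , k≤n , d∣aₘ-aₖ with ℕₚ.m≤n⇒m<n∨m≡n k≤n
  ...   | inj₁ k<n  = suc k , k<n , ∣-trans d∣aₘ-aₖ (f-∣ _ _)
  ...   | inj₂ refl = i , i≤n , subst (d ∣_) (telescope (a (suc m)) (a (suc k)) (a i))
                                   (∣m∣n⇒∣m+n (∣-trans d∣aₘ-aₖ (f-∣ _ _)) d∣)
    where
    telescope : ∀ x y z → x - y + (y - z) ≡ x - z
    telescope = solve-∀

complement : ∀ {j n} → j ≤ n → ∃ λ i → i ≤ n × i ℕ.+ j ≡ n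
complement {j} j≤n with o , j+o≡n ← ℕₚ.m≤n⇒∃[o]m+o≡n j≤n =
  o , subst (o ≤_) j+o≡n (ℕₚ.m≤n+m o j) , trans (ℕₚ.+-comm o j) j+o≡n

nilpotent⇒locallyNilpotent : ∀ u {r n} → NilpotentOfIndex u r n → LocallyNilpotentAt u r
nilpotent⇒locallyNilpotent u {n = n} (1≤n , uⁿ≡0 , _) p _ =
  n , 1≤n , subst (λ z → p ∣ₙ ∣ z ∣) (sym uⁿ≡0) (p ∣0)

module OrbitOfOne (u : Poly) where
  open Orbit (eval u) (eval-difference-∣ u) (+ 1)
  open FormValues u

  Counts : ℕ → Set
  Counts n = ∀ {i} → i ≤ n → a i ≡ + suc i

  counts-zero : Counts 0
  counts-zero z≤n = refl

  eval-after-counts : ∀ {n} → Counts n → eval u (+ suc n) ≡ a (suc n)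
  eval-after-counts c = cong (eval u) (sym (c ℕₚ.≤-refl))

  counts-extend : ∀ {n} → Counts n → eval u (+ suc n) ≡ + suc (suc n) → Counts (suc n)
  counts-extend {n} c u≡ i≤1+n with ℕₚ.m≤n⇒m<n∨m≡n i≤1+n
  ... | inj₁ (s≤s i≤n) = c i≤n
  ... | inj₂ refl      = trans (sym (eval-after-counts c)) u≡

  counts-eval : ∀ {n} → Counts (suc n) → ∀ {i} → i ≤ n → eval u (+ suc i) ≡ + suc (suc i)
  counts-eval c i≤n = trans (cong (eval u) (sym (c (ℕₚ.m≤n⇒m≤1+n i≤n)))) (c (s≤s i≤n))

  counted-divisor≤ : ∀ {n p m} → Counts n → + p ∣ a m → (∃ λ k → k ≤ n × + p ∣ a m - a k) → p ≤ suc n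
  counted-divisor≤ {p = p} {m} c p∣aₘ (k , k≤n , p∣aₘ-aₖ) = ℕₚ.≤-trans (∣⇒≤ (∣⇒∣ᵤ p∣aₖ)) (s≤s k≤n)
    where
    recover : ∀ x y → x - (x - y) ≡ y
    recover = solve-∀
    p∣aₖ : + p ∣ + suc k
    p∣aₖ = subst (+ p ∣_) (trans (recover (a m) (a k)) (c k≤n)) (∣m∣n⇒∣m-n p∣aₘ p∣aₘ-aₖ)

  staircase : ∀ {n} → LocallyNilpotentAt u (+ 1) → Counts n → Staircase n (a (suc n) - + suc (suc n))
  staircase {n} ln c = record { divisible = divisible ; smooth = smooth }
    where
    w = a (suc n) - + suc (suc n)
    gap : ∀ {i k} → i ≤ n → i ℕ.+ k ≡ suc n → a (suc n) - a i ≡ w + + k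
    gap {i} {k} i≤n i+k≡1+n = begin
      a (suc n) - a i                     ≡⟨ cong (λ t → a (suc n) - t) (c i≤n) ⟩
      a (suc n) - + suc i                 ≡⟨ shift (a (suc n)) (+ suc i) (+ k) ⟩
      a (suc n) - (+ suc i + + k) + + k   ≡⟨ cong (λ t → a (suc n) - t + + k) (sym 2+n≡) ⟩
      w + + k                             ∎
      where
      shift : ∀ x s k → x - s ≡ x - (s + k) + k
      shift = solve-∀
      2+n≡ : + suc (suc n) ≡ + suc i + + k
      2+n≡ = trans (cong (λ m → + suc m) (sym i+k≡1+n)) (ℤ.pos-+ (suc i) k)
    divisible : ∀ {k} → 1 ≤ k → k ≤ n → + k ∣ w
    divisible {suc k} _ 1+k≤n with i , i≤n , i+k≡n ← complement (ℕₚ.<⇒≤ 1+k≤n) =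
      ∣m+n∣n⇒∣m (subst₂ _∣_ aₖ₊₁-a₀ aₙ₊₁-aᵢ (orbit-∣ i (suc k))) ∣-refl
      where
      i+1+k≡1+n : i ℕ.+ suc k ≡ suc n
      i+1+k≡1+n = trans (ℕₚ.+-suc i k) (cong suc i+k≡n)
      aₖ₊₁-a₀ : a (suc k) - + 1 ≡ + suc k
      aₖ₊₁-a₀ = cong (_- + 1) (c 1+k≤n)
      aₙ₊₁-aᵢ : a (i ℕ.+ suc k) - a i ≡ w + + suc k
      aₙ₊₁-aᵢ = trans (cong (λ m → a m - a i) i+1+k≡1+n) (gap i≤n i+1+k≡1+n)
    smooth : ∀ {p j} → Prime p → j ≤ n → + p ∣ w + + suc j → p ≤ suc n
    smooth {p} {j} pp j≤n p∣w+1+j with i , i≤n , i+j≡n ← complement j≤n | m , _ , p∣aₘ ← ln p pp =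
      counted-divisor≤ {m = m} c (∣ᵤ⇒∣ p∣aₘ) (orbit-recurrent i≤n p∣aₙ₊₁-aᵢ m)
      where
      p∣aₙ₊₁-aᵢ : + p ∣ a (suc n) - a i
      p∣aₙ₊₁-aᵢ = subst (+ p ∣_) (sym (gap i≤n (trans (ℕₚ.+-suc i j) (cong suc i+j≡n)))) p∣w+1+j

  climb : ∀ {n} → LocallyNilpotentAt u (+ 1) → Counts n →
          Counts (suc n) ⊎ (eval u (+ suc n) ≡ + 0 × n ≤ 2)
  climb {n} ln c with staircase-solution n (staircase ln c)
  ... | inj₁ w≡0 =
    inj₁ (counts-extend c (trans (eval-after-counts c) (ℤ.i-j≡0⇒i≡j _ _ w≡0)))
  ... | inj₂ (w≡-[2+n] , n≤2) = inj₂ (trans (eval-after-counts c) (begin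
    a (suc n)                                  ≡⟨ unshift (a (suc n)) (+ suc (suc n)) ⟩
    a (suc n) - + suc (suc n) + + suc (suc n)  ≡⟨ cong (_+ + suc (suc n)) w≡-[2+n] ⟩
    - + suc (suc n) + + suc (suc n)            ≡⟨ ℤ.+-inverseˡ (+ suc (suc n)) ⟩
    + 0                                        ∎) , n≤2)
    where
    unshift : ∀ x c → x ≡ x - c + c
    unshift = solve-∀

  counts-forever : LocallyNilpotentAt u (+ 1) → Counts 3 → ∀ n → Counts (3 ℕ.+ n)
  counts-forever ln c₃ zero    = c₃
  counts-forever ln c₃ (suc n) with climb ln (counts-forever ln c₃ n)
  ... | inj₁ c = c
  ... | inj₂ (_ , s≤s (s≤s ()))

  locallyNilpotent⇒form : DegreeAtLeast1 u → LocallyNilpotentAt u (+ 1) →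
                          Form1 u ⊎ Form2 u ⊎ Form3 u ⊎ Form4 u
  locallyNilpotent⇒form deg ln = case climb ln counts-zero of λ where
    (inj₂ (u₁≡0 , _)) → inj₁ (root⇒form₁ deg u₁≡0)
    (inj₁ c₁) → case climb ln c₁ of λ where
      (inj₂ (u₂≡0 , _)) → inj₂ (inj₁ (values⇒form₂ (counts-eval c₁ z≤n) u₂≡0))
      (inj₁ c₂) → case climb ln c₂ of λ where
        (inj₂ (u₃≡0 , _)) →
          inj₂ (inj₂ (inj₁ (values⇒form₃ (counts-eval c₂ z≤n) (counts-eval c₂ (s≤s z≤n)) u₃≡0)))
        (inj₁ c₃) →
          inj₂ (inj₂ (inj₂ (values⇒form₄ λ k → counts-eval (counts-forever ln c₃ k) (ℕₚ.m≤n+m k 2))))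

  nilpotent-after-counts : ∀ {n} → Counts n → eval u (+ suc n) ≡ + 0 → NilpotentOfIndex u (+ 1) (suc n)
  nilpotent-after-counts c u≡0 =
    s≤s z≤n , trans (sym (eval-after-counts c)) u≡0 ,
    λ { k _ (s≤s k≤n) aₖ≡0 → case trans (sym (c k≤n)) aₖ≡0 of λ () }

  always-counts⇒locallyNilpotent : (∀ n → Counts n) → LocallyNilpotentAt u (+ 1)
  always-counts⇒locallyNilpotent c (suc (suc q)) _ =
    suc q , s≤s z≤n , subst (λ z → suc (suc q) ∣ₙ ∣ z ∣) (sym (c (suc q) ℕₚ.≤-refl)) ∣ₙ-refl

  always-counts⇒¬nilpotent : (∀ n → Counts n) → ¬ NilpotentAt u (+ 1)
  always-counts⇒¬nilpotent c (n , _ , aₙ≡0) = case trans (sym (c n ℕₚ.≤-refl)) aₙ≡0 of λ ()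

  values⇒counts : (∀ k → eval u (+ suc k) ≡ + suc (suc k)) → ∀ n → Counts n
  values⇒counts h zero    = counts-zero
  values⇒counts h (suc n) = counts-extend (values⇒counts h n) (h n)

  form₁-index : Form1 u → NilpotentOfIndex u (+ 1) 1
  form₁-index F = nilpotent-after-counts counts-zero (form₁-root F)

  form₂-index : Form2 u → NilpotentOfIndex u (+ 1) 2
  form₂-index F with u₁≡2 , u₂≡0 ← form₂-values F =
    nilpotent-after-counts (counts-extend counts-zero u₁≡2) u₂≡0

  form₃-index : Form3 u → NilpotentOfIndex u (+ 1) 3
  form₃-index F with u₁≡2 , u₂≡3 , u₃≡0 ← form₃-values F =
    nilpotent-after-counts (counts-extend (counts-extend counts-zero u₁≡2) u₂≡3) u₃≡0

  form₄-orbit : Form4 u → LocallyNilpotentAt u (+ 1) × ¬ NilpotentAt u (+ 1)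
  form₄-orbit F = always-counts⇒locallyNilpotent counts , always-counts⇒¬nilpotent counts
    where
    counts : ∀ n → Counts n
    counts = values⇒counts (λ k → form₄-values F (+ suc k))

theorem1 : (u : Poly) → DegreeAtLeast1 u →
    (LocallyNilpotentAt u (+ 1) ⇔ (Form1 u ⊎ Form2 u ⊎ Form3 u ⊎ Form4 u))
    × (Form1 u → NilpotentOfIndex u (+ 1) 1)
    × (Form2 u → NilpotentOfIndex u (+ 1) 2)
    × (Form3 u → NilpotentOfIndex u (+ 1) 3)
    × (Form4 u → LocallyNilpotentAt u (+ 1) × ¬ NilpotentAt u (+ 1))
theorem1 u deg =
    mk⇔ (locallyNilpotent⇒form deg) form⇒locallyNilpotent
  , form₁-index , form₂-index , form₃-index , form₄-orbit
  where
  open OrbitOfOne u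
  form⇒locallyNilpotent : Form1 u ⊎ Form2 u ⊎ Form3 u ⊎ Form4 u → LocallyNilpotentAt u (+ 1)
  form⇒locallyNilpotent (inj₁ F)               = nilpotent⇒locallyNilpotent u (form₁-index F)
  form⇒locallyNilpotent (inj₂ (inj₁ F))        = nilpotent⇒locallyNilpotent u (form₂-index F)
  form⇒locallyNilpotent (inj₂ (inj₂ (inj₁ F))) = nilpotent⇒locallyNilpotent u (form₃-index F)
  form⇒locallyNilpotent (inj₂ (inj₂ (inj₂ F))) = proj₁ (form₄-orbit F)
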